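{- For every $v=9\ell$ with $\ell\in\{1,2,3,\dots\}$, there exists a $3$-way $3$-homogeneous $(v,3,2)$ Steiner trade of volume $v$.
   Context: Let $V$ be a finite set with $v$ elements and let $t<k<v$ be positive integers. A $\mu$-way $(v,k,t)$ trade $T=\{T_1,\dots,T_\mu\}$ of volume $m$ consists of $\mu$ pairwise disjoint collections $T_1,\dots,T_\mu$, each of $m$ blocks ($k$-subsets of $V$), such that every $t$-subset of $V$ is contained in the same number of blocks in each $T_i$. The foundation $\mathrm{found}(T)$ is the set of elements covered by the blocks. It is a Steiner trade if every $t$-subset of $\mathrm{found}(T)$ is in at most one block of each $T_i$, and $d$-homogeneous if every element of $V$ lies in exactly $d$ blocks of each $T_i$. -}

module Defs where

open import Data.Nat using (ℕ; _≤_; _<_; _*_)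
open import Data.Fin using (Fin)
open import Data.Fin.Subset using (Subset; ∣_∣; _⊆_; _∈_; ⁅_⁆)
open import Data.Fin.Subset.Properties using (_⊆?_)
open import Data.Vec using (tabulate; count)
open import Data.Product using (_×_; ∃)
open import Relation.Binary.PropositionalEquality using (_≡_; _≢_)
open import Relation.Nullary using (¬_)

-- A collection of m blocks is an indexed family  Fin m → Subset v  whose
-- entries are pairwise distinct (so it is a set of m blocks).

Collection : ℕ → ℕ → Set
Collection v m = Fin m → Subset v

occ : ∀ {v m} → Collection v m → Subset v → ℕ
occ {m = m} C S = count (S ⊆?_) (tabulate C)

IsBlockSet : ∀ {v m} → ℕ → Collection v m → Set
IsBlockSet {v} {m} k C =
  (∀ j → ∣ C j ∣ ≡ k) × (∀ j j′ → C j ≡ C j′ → j ≡ j′)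

InFound : ∀ {μ v m} → (Fin μ → Collection v m) → Fin v → Set
InFound T x = ∃ λ i → ∃ λ j → x ∈ T i j

IsTrade : (μ v k t m : ℕ) → (Fin μ → Collection v m) → Set
IsTrade μ v k t m T =
  (∀ i → IsBlockSet k (T i))
  × (∀ i i′ j j′ → i ≢ i′ → T i j ≢ T i′ j′)
  × (∀ (S : Subset v) → ∣ S ∣ ≡ t → ∀ i i′ → occ (T i) S ≡ occ (T i′) S)

IsSteiner : ∀ {μ v m} → ℕ → (Fin μ → Collection v m) → Set
IsSteiner {v = v} t T =
  ∀ (S : Subset v) → ∣ S ∣ ≡ t → (∀ x → x ∈ S → InFound T x) →
  ∀ i → occ (T i) S ≤ 1

IsHomogeneous : ∀ {μ v m} → ℕ → (Fin μ → Collection v m) → Set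
IsHomogeneous {v = v} d T = ∀ (x : Fin v) → ∀ i → occ (T i) ⁅ x ⁆ ≡ d

-- The three collections of nine blocks { a , b , c } on three groups of three
-- points with c ≡ a + b + i (mod 3), i = 0, 1, 2, are disjoint (the three Latin
-- squares differ in every cell), and each covers every pair of points from
-- distinct groups exactly once and no other pair: a 3-homogeneous Steiner trade
-- of volume 9 on 9 points.  Placing copies of a trade on disjoint point sets
-- again gives a trade with all these properties, so ℓ + 1 copies settle
-- v = 9 (ℓ + 1).
module Submission where

open import Defs
open import Data.Bool using (true; false)
open import Data.Empty using (⊥-elim)
open import Data.Fin using (Fin; zero; suc; toℕ; _↑ˡ_; _↑ʳ_; splitAt; join; remQuot)
open import Data.Fin.Properties using (all?; join-splitAt) renaming (_≟_ to _≟ᶠ_)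
open import Data.Fin.Subset using (Subset; inside; outside; ⊥; ⁅_⁆; ∣_∣; _⊆_; Empty; Nonempty)
open import Data.Fin.Subset.Properties
  using (_⊆?_; nonempty?; anySubset?; Empty-unique; ∣⊥∣≡0; ∉⊥; x∈⁅x⁆; drop-∷-⊆; out⊆; in⊆in)
open import Data.Nat using (ℕ; zero; suc; _+_; _*_; _≤_; _≤?_; z≤n) renaming (_≟_ to _≟ⁿ_)
open import Data.Nat.DivMod using (_mod_)
open import Data.Nat.Properties using (+-identityʳ; *-comm)
open import Data.Product using (Σ; _×_; _,_; proj₁; proj₂)
open import Data.Sum using (_⊎_; inj₁; inj₂; map₁)
open import Data.Sum.Relation.Binary.Pointwise using (Pointwise; inj₁; inj₂)
open import Data.Vec using (Vec; []; _∷_; _++_; tabulate; count)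
import Data.Vec as Vec
open import Data.Vec.Properties using (++-injectiveˡ; ++-injectiveʳ; ≡-dec)
import Data.Bool.Properties as Bool
open import Function using (_∘_; _⇔_; mk⇔; Equivalence)
open import Level using (Level)
open import Relation.Binary.PropositionalEquality
  using (_≡_; _≢_; refl; sym; trans; cong; cong₂; subst)
open import Relation.Nullary using (Dec; yes; no; ¬_; does; contradiction)
open import Relation.Nullary.Decidable using (from-yes; map′; ¬?; _×-dec_; _→-dec_; decidable-stable)
open import Relation.Unary using (Pred; Decidable)

private
  variable
    a b p q : Level
    A B : Set a
    d k m n m₁ m₂ t v v₁ v₂ μ : ℕ

count-++ : {P : Pred A p} (P? : Decidable P) (xs : Vec A m) (ys : Vec A n) →
           count P? (xs ++ ys) ≡ count P? xs + count P? ys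
count-++ P? []       ys = refl
count-++ P? (x ∷ xs) ys with does (P? x)
... | true  = cong suc (count-++ P? xs ys)
... | false = count-++ P? xs ys

count-tabulate-⇔ : {P : Pred A p} {Q : Pred B q} (P? : Decidable P) (Q? : Decidable Q)
                   {f : Fin n → A} {g : Fin n → B} → (∀ i → P (f i) ⇔ Q (g i)) →
                   count P? (tabulate f) ≡ count Q? (tabulate g)
count-tabulate-⇔ {n = zero}  P? Q?         P⇔Q = refl
count-tabulate-⇔ {n = suc n} P? Q? {f} {g} P⇔Q with P? (f zero) | Q? (g zero)
... | yes _  | yes _  = cong suc (count-tabulate-⇔ P? Q? (P⇔Q ∘ suc))
... | no  _  | no  _  = count-tabulate-⇔ P? Q? (P⇔Q ∘ suc)
... | yes Pf | no ¬Qg = contradiction (Equivalence.to (P⇔Q zero) Pf) ¬Qg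
... | no ¬Pf | yes Qg = contradiction (Equivalence.from (P⇔Q zero) Qg) ¬Pf

count-tabulate-none : {P : Pred A p} (P? : Decidable P) {f : Fin n → A} →
                      (∀ i → ¬ P (f i)) → count P? (tabulate f) ≡ 0
count-tabulate-none {n = zero}  P?     ¬P = refl
count-tabulate-none {n = suc n} P? {f} ¬P with P? (f zero)
... | yes Pf = contradiction Pf (¬P zero)
... | no  _  = count-tabulate-none P? (¬P ∘ suc)

tabulate-splitAt : ∀ m (h : Fin m ⊎ Fin n → A) →
                   tabulate (h ∘ splitAt m) ≡ tabulate (h ∘ inj₁) ++ tabulate (h ∘ inj₂)
tabulate-splitAt zero    h = refl
tabulate-splitAt (suc m) h = cong (h (inj₁ zero) ∷_) (tabulate-splitAt m (h ∘ map₁ suc))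

++-⊆⁺ : {p r : Subset m} {q s : Subset n} → p ⊆ r → q ⊆ s → p ++ q ⊆ r ++ s
++-⊆⁺ {p = []}          {[]}          _   q⊆s = q⊆s
++-⊆⁺ {p = outside ∷ p} {_ ∷ r}       p⊆r q⊆s = out⊆ (++-⊆⁺ (drop-∷-⊆ p⊆r) q⊆s)
++-⊆⁺ {p = inside ∷ p}  {inside ∷ r}  p⊆r q⊆s = in⊆in (++-⊆⁺ (drop-∷-⊆ p⊆r) q⊆s)
++-⊆⁺ {p = inside ∷ p}  {outside ∷ r} p⊆r q⊆s = contradiction (p⊆r Vec.here) λ ()

++-⊆⁻ : {p r : Subset m} {q s : Subset n} → p ++ q ⊆ r ++ s → p ⊆ r × q ⊆ s
++-⊆⁻ {p = []}          {[]}          pq⊆rs = (λ ()) , pq⊆rs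
++-⊆⁻ {p = outside ∷ p} {_ ∷ r}       pq⊆rs with ++-⊆⁻ (drop-∷-⊆ pq⊆rs)
... | p⊆r , q⊆s = out⊆ p⊆r , q⊆s
++-⊆⁻ {p = inside ∷ p}  {inside ∷ r}  pq⊆rs with ++-⊆⁻ (drop-∷-⊆ pq⊆rs)
... | p⊆r , q⊆s = in⊆in p⊆r , q⊆s
++-⊆⁻ {p = inside ∷ p}  {outside ∷ r} pq⊆rs = contradiction (pq⊆rs Vec.here) λ ()

∣++∣ : (p : Subset m) (q : Subset n) → ∣ p ++ q ∣ ≡ ∣ p ∣ + ∣ q ∣
∣++∣ = count-++ (_≟ inside)
  where open Bool using (_≟_)

Empty⇒∣p∣≡0 : {p : Subset n} → Empty p → ∣ p ∣ ≡ 0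
Empty⇒∣p∣≡0 {n} p-empty = trans (cong ∣_∣ (Empty-unique p-empty)) (∣⊥∣≡0 n)

∣++∣-emptyˡ : (p : Subset m) (q : Subset n) → Empty p → ∣ p ++ q ∣ ≡ ∣ q ∣
∣++∣-emptyˡ p q p-empty = trans (∣++∣ p q) (cong (_+ ∣ q ∣) (Empty⇒∣p∣≡0 p-empty))

∣++∣-emptyʳ : (p : Subset m) (q : Subset n) → Empty q → ∣ p ++ q ∣ ≡ ∣ p ∣
∣++∣-emptyʳ p q q-empty =
  trans (∣++∣ p q) (trans (cong (∣ p ∣ +_) (Empty⇒∣p∣≡0 q-empty)) (+-identityʳ ∣ p ∣))

Empty-⊥ : Empty (⊥ {n})
Empty-⊥ (_ , x∈⊥) = ∉⊥ x∈⊥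

Empty⇒⊆⊥ : {p : Subset n} → Empty p → p ⊆ ⊥
Empty⇒⊆⊥ p-empty x∈p = contradiction (_ , x∈p) p-empty

∣p∣≡suc⇒p≢⊥ : {p : Subset n} → ∣ p ∣ ≡ suc k → p ≢ ⊥
∣p∣≡suc⇒p≢⊥ {n} ∣p∣≡ refl with trans (sym ∣p∣≡) (∣⊥∣≡0 n)
... | ()

⁅↑ˡ⁆ : ∀ (i : Fin m) n → ⁅ i ↑ˡ n ⁆ ≡ ⁅ i ⁆ ++ ⊥ {n}
⁅↑ˡ⁆ {suc m} zero    n = cong (inside ∷_) (⊥++⊥ m)
  where
  ⊥++⊥ : ∀ m → ⊥ {m + n} ≡ ⊥ {m} ++ ⊥ {n}
  ⊥++⊥ zero    = refl
  ⊥++⊥ (suc m) = cong (outside ∷_) (⊥++⊥ m)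
⁅↑ˡ⁆         (suc i) n = cong (outside ∷_) (⁅↑ˡ⁆ i n)

⁅↑ʳ⁆ : ∀ m (j : Fin n) → ⁅ m ↑ʳ j ⁆ ≡ ⊥ {m} ++ ⁅ j ⁆
⁅↑ʳ⁆ zero    j = refl
⁅↑ʳ⁆ (suc m) j = cong (outside ∷_) (⁅↑ʳ⁆ m j)

blockSum : Collection v₁ m₁ → Collection v₂ m₂ → Fin m₁ ⊎ Fin m₂ → Subset (v₁ + v₂)
blockSum C D (inj₁ r) = C r ++ ⊥
blockSum C D (inj₂ j) = ⊥ ++ D j

infixr 5 _⊕_
_⊕_ : Collection v₁ m₁ → Collection v₂ m₂ → Collection (v₁ + v₂) (m₁ + m₂)
_⊕_ {m₁ = m₁} C D = blockSum C D ∘ splitAt m₁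

module _ (C : Collection v₁ m₁) (D : Collection v₂ m₂) (S₁ : Subset v₁) (S₂ : Subset v₂) where

  private
    occˡ occʳ : ℕ
    occˡ = count ((S₁ ++ S₂) ⊆?_) (tabulate (blockSum C D ∘ inj₁))
    occʳ = count ((S₁ ++ S₂) ⊆?_) (tabulate (blockSum C D ∘ inj₂))

    occ-⊕-split : occ (C ⊕ D) (S₁ ++ S₂) ≡ occˡ + occʳ
    occ-⊕-split = trans (cong (count _) (tabulate-splitAt m₁ (blockSum C D)))
                        (count-++ _ (tabulate (blockSum C D ∘ inj₁)) _)

    occˡ-empty : Empty S₂ → occˡ ≡ occ C S₁
    occˡ-empty S₂-empty = count-tabulate-⇔ ((S₁ ++ S₂) ⊆?_) (S₁ ⊆?_) {g = C} λ r →
      mk⇔ (proj₁ ∘ ++-⊆⁻) λ S₁⊆ → ++-⊆⁺ S₁⊆ (Empty⇒⊆⊥ S₂-empty)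

    occʳ-empty : Empty S₁ → occʳ ≡ occ D S₂
    occʳ-empty S₁-empty = count-tabulate-⇔ ((S₁ ++ S₂) ⊆?_) (S₂ ⊆?_) {g = D} λ j →
      mk⇔ (proj₂ ∘ ++-⊆⁻) λ S₂⊆ → ++-⊆⁺ (Empty⇒⊆⊥ S₁-empty) S₂⊆

    occˡ-nonempty : Nonempty S₂ → occˡ ≡ 0
    occˡ-nonempty (_ , x∈S₂) =
      count-tabulate-none _ λ r S⊆ → ∉⊥ (proj₂ (++-⊆⁻ {r = C r} S⊆) x∈S₂)

    occʳ-nonempty : Nonempty S₁ → occʳ ≡ 0
    occʳ-nonempty (_ , x∈S₁) =
      count-tabulate-none _ λ j S⊆ → ∉⊥ (proj₁ (++-⊆⁻ {s = D j} S⊆) x∈S₁)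

  occ-⊕ˡ : Nonempty S₁ → Empty S₂ → occ (C ⊕ D) (S₁ ++ S₂) ≡ occ C S₁
  occ-⊕ˡ S₁-nonempty S₂-empty = trans occ-⊕-split
    (trans (cong₂ _+_ (occˡ-empty S₂-empty) (occʳ-nonempty S₁-nonempty)) (+-identityʳ _))

  occ-⊕ʳ : Empty S₁ → Nonempty S₂ → occ (C ⊕ D) (S₁ ++ S₂) ≡ occ D S₂
  occ-⊕ʳ S₁-empty S₂-nonempty = trans occ-⊕-split
    (cong₂ _+_ (occˡ-nonempty S₂-nonempty) (occʳ-empty S₁-empty))

  occ-⊕-straddle : Nonempty S₁ → Nonempty S₂ → occ (C ⊕ D) (S₁ ++ S₂) ≡ 0
  occ-⊕-straddle S₁-nonempty S₂-nonempty = trans occ-⊕-split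
    (cong₂ _+_ (occˡ-nonempty S₂-nonempty) (occʳ-nonempty S₁-nonempty))

splitAt-injective : ∀ m {i j : Fin (m + n)} → splitAt m i ≡ splitAt m j → i ≡ j
splitAt-injective {n} m {i} {j} e =
  trans (sym (join-splitAt m n i)) (trans (cong (join m n) e) (join-splitAt m n j))

blockSum-≡ : {C C′ : Collection v₁ m₁} {D D′ : Collection v₂ m₂} →
             (∀ r → C r ≢ ⊥) → (∀ r → C′ r ≢ ⊥) →
             ∀ x y → blockSum C D x ≡ blockSum C′ D′ y →
             Pointwise (λ r r′ → C r ≡ C′ r′) (λ j j′ → D j ≡ D′ j′) x y
blockSum-≡ {C = C} {C′} C≢⊥ C′≢⊥ (inj₁ r) (inj₁ r′) e = inj₁ (++-injectiveˡ (C r) (C′ r′) e)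
blockSum-≡ {C = C}      C≢⊥ C′≢⊥ (inj₁ r) (inj₂ j′) e = ⊥-elim (C≢⊥ r (++-injectiveˡ (C r) ⊥ e))
blockSum-≡ {C′ = C′}    C≢⊥ C′≢⊥ (inj₂ j) (inj₁ r′) e = ⊥-elim (C′≢⊥ r′ (sym (++-injectiveˡ ⊥ (C′ r′) e)))
blockSum-≡              C≢⊥ C′≢⊥ (inj₂ j) (inj₂ j′) e = inj₂ (++-injectiveʳ ⊥ ⊥ e)

IsDisjoint : (Fin μ → Collection n m) → Set
IsDisjoint T = ∀ i i′ j j′ → i ≢ i′ → T i j ≢ T i′ j′

IsBalanced : ℕ → (Fin μ → Collection n m) → Set
IsBalanced {n = n} t T = ∀ (S : Subset n) → ∣ S ∣ ≡ t → ∀ i i′ → occ (T i) S ≡ occ (T i′) S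

-- IsSteiner without the restriction to the foundation, so that it splits along ⊕.
IsPacking : ℕ → (Fin μ → Collection n m) → Set
IsPacking {n = n} t T = ∀ (S : Subset n) → ∣ S ∣ ≡ t → ∀ i → occ (T i) S ≤ 1

infixr 5 _⊕ᵗ_
_⊕ᵗ_ : (Fin μ → Collection v₁ m₁) → (Fin μ → Collection v₂ m₂) →
       Fin μ → Collection (v₁ + v₂) (m₁ + m₂)
(T₁ ⊕ᵗ T₂) i = T₁ i ⊕ T₂ i

⊕-isBlockSet : {C : Collection v₁ m₁} {D : Collection v₂ m₂} →
               IsBlockSet (suc k) C → IsBlockSet (suc k) D → IsBlockSet (suc k) (C ⊕ D)
⊕-isBlockSet {v₁} {m₁} {v₂} {k = k} {C = C} {D} (∣C∣ , C-inj) (∣D∣ , D-inj) =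
  size ∘ splitAt m₁ ,
  λ j j′ → splitAt-injective m₁ ∘ blockSum-injective (splitAt m₁ j) (splitAt m₁ j′)
  where
  size : ∀ x → ∣ blockSum C D x ∣ ≡ suc k
  size (inj₁ r) = trans (∣++∣ (C r) ⊥) (trans (cong₂ _+_ (∣C∣ r) (∣⊥∣≡0 v₂)) (+-identityʳ _))
  size (inj₂ j) = trans (∣++∣ (⊥ {v₁}) (D j)) (cong₂ _+_ (∣⊥∣≡0 v₁) (∣D∣ j))

  C≢⊥ : ∀ r → C r ≢ ⊥
  C≢⊥ r = ∣p∣≡suc⇒p≢⊥ (∣C∣ r)

  blockSum-injective : ∀ x y → blockSum C D x ≡ blockSum C D y → x ≡ y
  blockSum-injective x y e with blockSum-≡ C≢⊥ C≢⊥ x y e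
  ... | inj₁ e₁ = cong inj₁ (C-inj _ _ e₁)
  ... | inj₂ e₂ = cong inj₂ (D-inj _ _ e₂)

⊕-disjoint : {T₁ : Fin μ → Collection v₁ m₁} {T₂ : Fin μ → Collection v₂ m₂} →
             (∀ i → IsBlockSet (suc k) (T₁ i)) →
             IsDisjoint T₁ → IsDisjoint T₂ → IsDisjoint (T₁ ⊕ᵗ T₂)
⊕-disjoint {m₁ = m₁} {T₁ = T₁} {T₂} blocks₁ disjoint₁ disjoint₂ i i′ j j′ i≢i′ =
  blockSum-disjoint (splitAt m₁ j) (splitAt m₁ j′)
  where
  T₁-nonempty : ∀ i r → T₁ i r ≢ ⊥
  T₁-nonempty i r = ∣p∣≡suc⇒p≢⊥ (proj₁ (blocks₁ i) r)

  blockSum-disjoint : ∀ x y → blockSum (T₁ i) (T₂ i) x ≢ blockSum (T₁ i′) (T₂ i′) y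
  blockSum-disjoint x y e with blockSum-≡ (T₁-nonempty i) (T₁-nonempty i′) x y e
  ... | inj₁ e₁ = disjoint₁ i i′ _ _ i≢i′ e₁
  ... | inj₂ e₂ = disjoint₂ i i′ _ _ i≢i′ e₂

occ-⊕-cases : ∀ (S₁ : Subset v₁) (S₂ : Subset v₂) → ∣ S₁ ++ S₂ ∣ ≡ suc t →
  (∣ S₁ ∣ ≡ suc t × (∀ {m₁ m₂} (C : Collection v₁ m₁) (D : Collection v₂ m₂) →
                      occ (C ⊕ D) (S₁ ++ S₂) ≡ occ C S₁))
  ⊎ (∣ S₂ ∣ ≡ suc t × (∀ {m₁ m₂} (C : Collection v₁ m₁) (D : Collection v₂ m₂) →
                      occ (C ⊕ D) (S₁ ++ S₂) ≡ occ D S₂))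
  ⊎ (∀ {m₁ m₂} (C : Collection v₁ m₁) (D : Collection v₂ m₂) → occ (C ⊕ D) (S₁ ++ S₂) ≡ 0)
occ-⊕-cases S₁ S₂ ∣S∣ with nonempty? S₁ | nonempty? S₂
... | yes S₁-nonempty | no S₂-empty = inj₁
  (trans (sym (∣++∣-emptyʳ S₁ S₂ S₂-empty)) ∣S∣ ,
   λ C D → occ-⊕ˡ C D S₁ S₂ S₁-nonempty S₂-empty)
... | no S₁-empty | yes S₂-nonempty = inj₂ (inj₁
  (trans (sym (∣++∣-emptyˡ S₁ S₂ S₁-empty)) ∣S∣ ,
   λ C D → occ-⊕ʳ C D S₁ S₂ S₁-empty S₂-nonempty))
... | yes S₁-nonempty | yes S₂-nonempty = inj₂ (inj₂
  λ C D → occ-⊕-straddle C D S₁ S₂ S₁-nonempty S₂-nonempty)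
... | no S₁-empty | no S₂-empty
  with trans (sym ∣S∣) (trans (∣++∣-emptyˡ S₁ S₂ S₁-empty) (Empty⇒∣p∣≡0 S₂-empty))
...   | ()

module _ {T₁ : Fin μ → Collection v₁ m₁} {T₂ : Fin μ → Collection v₂ m₂} where

  ⊕-balanced : IsBalanced (suc t) T₁ → IsBalanced (suc t) T₂ → IsBalanced (suc t) (T₁ ⊕ᵗ T₂)
  ⊕-balanced balanced₁ balanced₂ S ∣S∣ i i′ with Vec.splitAt v₁ S
  ... | S₁ , S₂ , refl with occ-⊕-cases S₁ S₂ ∣S∣
  ... | inj₁ (∣S₁∣ , occ≡) =
    trans (occ≡ (T₁ i) (T₂ i)) (trans (balanced₁ S₁ ∣S₁∣ i i′) (sym (occ≡ (T₁ i′) (T₂ i′))))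
  ... | inj₂ (inj₁ (∣S₂∣ , occ≡)) =
    trans (occ≡ (T₁ i) (T₂ i)) (trans (balanced₂ S₂ ∣S₂∣ i i′) (sym (occ≡ (T₁ i′) (T₂ i′))))
  ... | inj₂ (inj₂ occ≡0) = trans (occ≡0 (T₁ i) (T₂ i)) (sym (occ≡0 (T₁ i′) (T₂ i′)))

  ⊕-packing : IsPacking (suc t) T₁ → IsPacking (suc t) T₂ → IsPacking (suc t) (T₁ ⊕ᵗ T₂)
  ⊕-packing packing₁ packing₂ S ∣S∣ i with Vec.splitAt v₁ S
  ... | S₁ , S₂ , refl with occ-⊕-cases S₁ S₂ ∣S∣
  ... | inj₁ (∣S₁∣ , occ≡) = subst (_≤ 1) (sym (occ≡ (T₁ i) (T₂ i))) (packing₁ S₁ ∣S₁∣ i)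
  ... | inj₂ (inj₁ (∣S₂∣ , occ≡)) = subst (_≤ 1) (sym (occ≡ (T₁ i) (T₂ i))) (packing₂ S₂ ∣S₂∣ i)
  ... | inj₂ (inj₂ occ≡0) = subst (_≤ 1) (sym (occ≡0 (T₁ i) (T₂ i))) z≤n

  ⊕-homogeneous : IsHomogeneous d T₁ → IsHomogeneous d T₂ → IsHomogeneous d (T₁ ⊕ᵗ T₂)
  ⊕-homogeneous {d = d} homogeneous₁ homogeneous₂ x i =
    subst (λ y → occ (T₁ i ⊕ T₂ i) ⁅ y ⁆ ≡ d) (join-splitAt v₁ v₂ x) (occ-⁅join⁆ (splitAt v₁ x))
    where
    occ-⁅join⁆ : ∀ y → occ (T₁ i ⊕ T₂ i) ⁅ join v₁ v₂ y ⁆ ≡ d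
    occ-⁅join⁆ (inj₁ r) = trans (cong (occ (T₁ i ⊕ T₂ i)) (⁅↑ˡ⁆ r v₂))
      (trans (occ-⊕ˡ (T₁ i) (T₂ i) ⁅ r ⁆ ⊥ (r , x∈⁅x⁆ r) Empty-⊥) (homogeneous₁ r i))
    occ-⁅join⁆ (inj₂ j) = trans (cong (occ (T₁ i ⊕ T₂ i)) (⁅↑ʳ⁆ v₁ j))
      (trans (occ-⊕ʳ (T₁ i) (T₂ i) ⊥ ⁅ j ⁆ Empty-⊥ (j , x∈⁅x⁆ j)) (homogeneous₂ j i))

HomogeneousPackingTrade : (μ k t d v : ℕ) → Set
HomogeneousPackingTrade μ k t d v =
  Σ (Fin μ → Collection v v) λ T → IsTrade μ v k t v T × IsPacking t T × IsHomogeneous d T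

homogeneousPackingTrade⇒steiner :
  HomogeneousPackingTrade μ k t d v →
  Σ (Fin μ → Collection v v) λ T → IsTrade μ v k t v T × IsSteiner t T × IsHomogeneous d T
homogeneousPackingTrade⇒steiner (T , trade , packing , homogeneous) =
  T , trade , (λ S ∣S∣ _ → packing S ∣S∣) , homogeneous

emptyTrade : HomogeneousPackingTrade μ k t d 0
emptyTrade = (λ _ ())
           , ((λ _ → (λ ()) , λ ()) , (λ _ _ ()) , λ _ _ _ _ → refl)
           , (λ _ _ _ → z≤n)
           , λ ()

⊕-homogeneousPackingTrade : HomogeneousPackingTrade μ (suc k) (suc t) d v₁ →
                            HomogeneousPackingTrade μ (suc k) (suc t) d v₂ →
                            HomogeneousPackingTrade μ (suc k) (suc t) d (v₁ + v₂)
⊕-homogeneousPackingTrade (T₁ , (blocks₁ , disjoint₁ , balanced₁) , packing₁ , homogeneous₁)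
                          (T₂ , (blocks₂ , disjoint₂ , balanced₂) , packing₂ , homogeneous₂) =
  T₁ ⊕ᵗ T₂ ,
  ((λ i → ⊕-isBlockSet (blocks₁ i) (blocks₂ i)) ,
   ⊕-disjoint blocks₁ disjoint₁ disjoint₂ ,
   ⊕-balanced {T₁ = T₁} {T₂} balanced₁ balanced₂) ,
  ⊕-packing {T₁ = T₁} {T₂} packing₁ packing₂ ,
  ⊕-homogeneous {T₁ = T₁} {T₂} homogeneous₁ homogeneous₂

copies : HomogeneousPackingTrade μ (suc k) (suc t) d v → ∀ ℓ →
         HomogeneousPackingTrade μ (suc k) (suc t) d (ℓ * v)
copies T zero    = emptyTrade
copies T (suc ℓ) = ⊕-homogeneousPackingTrade T (copies T ℓ)

allSubsets? : {P : Pred (Subset n) p} → Decidable P → Dec (∀ S → P S)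
allSubsets? P? = map′ (λ ¬∃¬P S → decidable-stable (P? S) λ ¬PS → ¬∃¬P (S , ¬PS))
                      (λ ∀P (S , ¬PS) → ¬PS (∀P S))
                      (¬? (anySubset? (¬? ∘ P?)))

_≟ˢ_ : (p q : Subset n) → Dec (p ≡ q)
_≟ˢ_ = ≡-dec Bool._≟_

latinTrade : Fin 3 → Collection 9 9
latinTrade i cell = ⁅ row ⁆ ++ ⁅ col ⁆ ++ ⁅ (toℕ i + toℕ row + toℕ col) mod 3 ⁆
  where
  row col : Fin 3
  row = proj₁ (remQuot {3} 3 cell)
  col = proj₂ (remQuot {3} 3 cell)

latinTrade-homogeneousPackingTrade : HomogeneousPackingTrade 3 3 2 3 9
latinTrade-homogeneousPackingTrade =
  latinTrade , (blockSets , disjoint , balanced) , packing , homogeneous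
  where
  blockSets : ∀ i → IsBlockSet 3 (latinTrade i)
  blockSets = from-yes (all? λ i →
    (all? λ r → ∣ latinTrade i r ∣ ≟ⁿ 3) ×-dec
    (all? λ r → all? λ r′ → (latinTrade i r ≟ˢ latinTrade i r′) →-dec (r ≟ᶠ r′)))

  disjoint : IsDisjoint latinTrade
  disjoint = from-yes (all? λ i → all? λ i′ → all? λ r → all? λ r′ →
    ¬? (i ≟ᶠ i′) →-dec ¬? (latinTrade i r ≟ˢ latinTrade i′ r′))

  balanced : IsBalanced 2 latinTrade
  balanced = from-yes (allSubsets? λ S → (∣ S ∣ ≟ⁿ 2) →-dec
    all? λ i → all? λ i′ → occ (latinTrade i) S ≟ⁿ occ (latinTrade i′) S)

  packing : IsPacking 2 latinTrade
  packing = from-yes (allSubsets? λ S → (∣ S ∣ ≟ⁿ 2) →-dec all? λ i → occ (latinTrade i) S ≤? 1)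

  homogeneous : IsHomogeneous 3 latinTrade
  homogeneous = from-yes (all? λ x → all? λ i → occ (latinTrade i) ⁅ x ⁆ ≟ⁿ 3)

lemma2p1 : ∀ (ℓ : ℕ) → let v = 9 * suc ℓ in
    Σ (Fin 3 → Collection v v) λ T →
      IsTrade 3 v 3 2 v T × IsSteiner 2 T × IsHomogeneous 3 T
lemma2p1 ℓ = homogeneousPackingTrade⇒steiner
  (subst (HomogeneousPackingTrade 3 3 2 3) (*-comm (suc ℓ) 9)
         (copies latinTrade-homogeneousPackingTrade (suc ℓ)))
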